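{- The polynomials $I_n(x)=\sum_{k=0}^{n-1}i_{n,k}x^k$ are in general not log-concave: there exists a positive integer $n$ such that the coefficient sequence $(i_{n,k})_{k}$ satisfies $i_{n,k-1}\,i_{n,k+1}>i_{n,k}^2$ for some $k$.
   Context: For a positive integer $n$, $i_{n,k}$ denotes the number of involutions $\sigma$ of $\{1,\dots,n\}$ with exactly $k$ descents, where a descent of $\sigma$ is an index $1\le i<n$ with $\sigma(i)>\sigma(i+1)$. A sequence $(s_i)$ is log-concave if $s_{i-1}s_{i+1}\le s_i^2$ for every $i>0$. -}

module Defs where

open import Data.Nat using (ℕ; zero; suc; _+_)
open import Data.Bool using (if_then_else_)
open import Data.Fin using (Fin; _<?_)
open import Data.Fin.Properties using (all?)
open import Data.Vec using (Vec; []; _∷_; lookup)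
open import Data.List using (List; []; _∷_; concatMap; map; length; filter)
open import Data.List using () renaming (allFin to allFinL)
open import Data.Product using (_×_)
open import Relation.Nullary using (Dec; does; _×-dec_)
open import Relation.Unary using (Pred; Decidable)
open import Relation.Binary.PropositionalEquality using (_≡_)
open import Data.Fin using (_≟_)
open import Level using (0ℓ)

-- A map σ : {1..n} → {1..n} is represented in one-line notation as the
-- vector (σ(1), …, σ(n)) : Vec (Fin n) n (0-indexed).

allVecs : {A : Set} → List A → (m : ℕ) → List (Vec A m)
allVecs xs zero    = [] ∷ []
allVecs xs (suc m) = concatMap (λ x → map (x ∷_) (allVecs xs m)) xs

allMaps : (n : ℕ) → List (Vec (Fin n) n)
allMaps n = allVecs (allFinL n) n

-- σ is an involution: σ(σ(i)) = i for all i (this forces σ to be a permutation)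
IsInvolution : {n : ℕ} → Vec (Fin n) n → Set
IsInvolution {n} σ = ∀ (i : Fin n) → lookup σ (lookup σ i) ≡ i

isInvolution? : {n : ℕ} → (σ : Vec (Fin n) n) → Dec (IsInvolution σ)
isInvolution? σ = all? (λ i → lookup σ (lookup σ i) ≟ i)

descents : {n m : ℕ} → Vec (Fin n) m → ℕ
descents [] = 0
descents (x ∷ []) = 0
descents (x ∷ y ∷ rest) = (if does (y <? x) then 1 else 0) + descents (y ∷ rest)

HasInvDes : (n k : ℕ) → Vec (Fin n) n → Set
HasInvDes n k σ = IsInvolution σ × (descents σ ≡ k)

hasInvDes? : (n k : ℕ) → (σ : Vec (Fin n) n) → Dec (HasInvDes n k σ)
hasInvDes? n k σ = isInvolution? σ ×-dec (descents σ Data.Nat.≟ k)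
  where import Data.Nat

invDes : (n k : ℕ) → ℕ
invDes n k = length (filter (hasInvDes? n k) (allMaps n))

module Submission where

-- An involution with a single descent is increasing on both sides of it, which pins it down as
-- the identity with two adjacent blocks of equal length exchanged (`swapPattern`); hence
-- i(n,1) ≤ n². Cutting {0, …, n-1} into nine blocks of lengths a, x, y, x, b, z, y, z, c and
-- exchanging blocks 1 ↔ 3, 2 ↔ 6 and 5 ↔ 7 gives an involution with exactly two descents, and
-- different (a, b, x, y, z) ∈ [1, p]⁵ give different involutions; with n = 8p + 1 this yields
-- i(n,2) ≥ p⁵. As i(n,0) ≥ 1, log-concavity fails at k = 1 as soon as n⁴ < p⁵, e.g. for p = 4300.

open import Defs
open import Data.Bool using (true; false; T; if_then_else_)
open import Data.Empty using (⊥; ⊥-elim)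
open import Data.Fin as Fin using (Fin; toℕ; fromℕ<)
open import Data.Fin.Properties using (toℕ-injective; toℕ-fromℕ<; toℕ<n)
open import Data.List as List using (List; []; _∷_; length; map; concatMap; _++_; filter)
open import Data.Nat.Induction using (<-rec)
open import Data.Nat.ListAction using (sum)
open import Data.Nat.Tactic.RingSolver using (solve-∀)
import Data.List.Properties as List
open import Data.List.Membership.Propositional using (_∈_)
open import Data.List.Membership.Propositional.Properties
  using (∈-allFin; ∈-upTo⁺; ∈-concatMap⁺; ∈-map⁺; ∈-map⁻; ∈-filter⁺; ∈-filter⁻)
open import Data.List.Relation.Unary.All as All using (All)
import Data.List.Relation.Unary.All.Properties as All
import Data.List.Relation.Unary.AllPairs as AllPairs
import Data.List.Relation.Unary.AllPairs.Properties as AllPairs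
open import Data.List.Relation.Unary.Any as Any using (here; there)
open import Data.List.Relation.Unary.Unique.Propositional using (Unique)
import Data.List.Relation.Unary.Unique.Propositional.Properties as Unique
open import Data.Nat
open import Data.Nat.Properties
open import Data.Product using (Σ; ∃-syntax; _×_; _,_; proj₁; proj₂)
open import Data.Sum using (inj₁; inj₂)
open import Data.Unit using (tt)
open import Data.Vec as Vec using (Vec; []; _∷_; lookup)
import Data.Vec.Properties as Vec
open import Function using (_∘_)
open import Relation.Binary using (tri<; tri≈; tri>)
open import Relation.Binary.PropositionalEquality
open import Relation.Nullary using (yes; no; ¬_)
open import Relation.Nullary.Decidable using (from-yes)

nth : List ℕ → ℕ → ℕ
nth []      _       = 0
nth (x ∷ l) zero    = x
nth (x ∷ l) (suc i) = nth l i

Bounded : List ℕ → ℕ → Set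
Bounded l n = ∀ i → i < length l → nth l i < n

Involutive : List ℕ → Set
Involutive l = ∀ i → i < length l → nth l (nth l i) ≡ i

nth-extensional : ∀ (l l′ : List ℕ) → length l ≡ length l′ →
                  (∀ i → i < length l → nth l i ≡ nth l′ i) → l ≡ l′
nth-extensional []      []        _  _  = refl
nth-extensional (x ∷ l) (x′ ∷ l′) eq pt =
  cong₂ _∷_ (pt 0 z<s) (nth-extensional l l′ (suc-injective eq) (λ i i< → pt (suc i) (s<s i<)))

nth-++ˡ : ∀ (l l′ : List ℕ) {i} → i < length l → nth (l ++ l′) i ≡ nth l i
nth-++ˡ (x ∷ l) l′ {zero}  _       = refl
nth-++ˡ (x ∷ l) l′ {suc i} (s<s p) = nth-++ˡ l l′ p

nth-++ʳ : ∀ (l l′ : List ℕ) j → nth (l ++ l′) (length l + j) ≡ nth l′ j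
nth-++ʳ []      l′ j = refl
nth-++ʳ (x ∷ l) l′ j = nth-++ʳ l l′ j

<nth⇒<length : ∀ l {j t} → t < nth l j → j < length l
<nth⇒<length (x ∷ l) {zero}  _  = z<s
<nth⇒<length (x ∷ l) {suc j} t< = s<s (<nth⇒<length l t<)

nth-map : ∀ (f : ℕ → ℕ) (l : List ℕ) {i} → i < length l → nth (map f l) i ≡ f (nth l i)
nth-map f (x ∷ l) {zero}  _       = refl
nth-map f (x ∷ l) {suc i} (s<s p) = nth-map f l p

all-below : ∀ {P : ℕ → Set} {n} → All P (List.upTo n) → ∀ i → i < n → P i
all-below all i i< = All.lookup all (∈-upTo⁺ i<)

nth-All : ∀ {P : ℕ → Set} {l k} → All P l → k < length l → P (nth l k)
nth-All {k = zero}  (p All.∷ _)  _       = p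
nth-All {k = suc k} (_ All.∷ ps) (s<s q) = nth-All ps q

-- Agrees definitionally with the test `y <? x` on Fin used by `descents`.
isDescent : ℕ → ℕ → ℕ
isDescent x y = if y <ᵇ x then 1 else 0

descentsℕ : List ℕ → ℕ
descentsℕ []          = 0
descentsℕ (x ∷ [])    = 0
descentsℕ (x ∷ y ∷ l) = isDescent x y + descentsℕ (y ∷ l)

isDescent-≤ : ∀ {x y} → x ≤ y → isDescent x y ≡ 0
isDescent-≤ {x} {y} x≤y with y <ᵇ x in e
... | true  = ⊥-elim (<⇒≱ (<ᵇ⇒< y x (subst T (sym e) tt)) x≤y)
... | false = refl

isDescent-> : ∀ {x y} → y < x → isDescent x y ≡ 1
isDescent-> {x} {y} y<x with y <ᵇ x in e
... | true  = refl
... | false = ⊥-elim (subst T e (<⇒<ᵇ y<x))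

isDescent≡0⇒≤ : ∀ {x y} → isDescent x y ≡ 0 → x ≤ y
isDescent≡0⇒≤ {x} {y} eq = ≮⇒≥ (λ y<x → 1+n≢0 (trans (sym (isDescent-> y<x)) eq))

values : ∀ {n m} → Vec (Fin n) m → List ℕ
values []      = []
values (x ∷ v) = toℕ x ∷ values v

length-values : ∀ {n m} (v : Vec (Fin n) m) → length (values v) ≡ m
length-values []      = refl
length-values (x ∷ v) = cong suc (length-values v)

lookup-values : ∀ {n m} (v : Vec (Fin n) m) (i : Fin m) → toℕ (lookup v i) ≡ nth (values v) (toℕ i)
lookup-values (x ∷ v) Fin.zero    = refl
lookup-values (x ∷ v) (Fin.suc i) = lookup-values v i

values-injective : ∀ {n m} (u v : Vec (Fin n) m) → values u ≡ values v → u ≡ v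
values-injective []      []      _  = refl
values-injective (x ∷ u) (y ∷ v) eq =
  cong₂ _∷_ (toℕ-injective (List.∷-injectiveˡ eq)) (values-injective u v (List.∷-injectiveʳ eq))

values-bounded : ∀ {n m} (v : Vec (Fin n) m) → Bounded (values v) n
values-bounded (x ∷ v) zero    _       = toℕ<n x
values-bounded (x ∷ v) (suc i) (s<s p) = values-bounded v i p

descents-values : ∀ {n m} (v : Vec (Fin n) m) → descents v ≡ descentsℕ (values v)
descents-values []          = refl
descents-values (x ∷ [])    = refl
descents-values (x ∷ y ∷ v) = cong (isDescent (toℕ x) (toℕ y) +_) (descents-values (y ∷ v))

isInvolution⇒involutive : ∀ {n} (σ : Vec (Fin n) n) → IsInvolution σ → Involutive (values σ)
isInvolution⇒involutive σ inv i i< = begin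
  nth (values σ) (nth (values σ) i)            ≡⟨ cong (λ j → nth (values σ) (nth (values σ) j)) (sym (toℕ-fromℕ< i<n)) ⟩
  nth (values σ) (nth (values σ) (toℕ k))      ≡⟨ cong (nth (values σ)) (sym (lookup-values σ k)) ⟩
  nth (values σ) (toℕ (lookup σ k))            ≡⟨ sym (lookup-values σ (lookup σ k)) ⟩
  toℕ (lookup σ (lookup σ k))                  ≡⟨ cong toℕ (inv k) ⟩
  toℕ k                                        ≡⟨ toℕ-fromℕ< i<n ⟩
  i                                            ∎
  where
  open ≡-Reasoning
  i<n = subst (i <_) (length-values σ) i<
  k = fromℕ< i<n

involutive⇒isInvolution : ∀ {n} (σ : Vec (Fin n) n) → Involutive (values σ) → IsInvolution σ
involutive⇒isInvolution σ inv i = toℕ-injective (begin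
  toℕ (lookup σ (lookup σ i))              ≡⟨ lookup-values σ (lookup σ i) ⟩
  nth (values σ) (toℕ (lookup σ i))        ≡⟨ cong (nth (values σ)) (lookup-values σ i) ⟩
  nth (values σ) (nth (values σ) (toℕ i))  ≡⟨ inv (toℕ i) (subst (toℕ i <_) (sym (length-values σ)) (toℕ<n i)) ⟩
  toℕ i                                    ∎)
  where open ≡-Reasoning

fromValues : ∀ {n m} (l : List ℕ) → length l ≡ m → Bounded l n → Vec (Fin n) m
fromValues {m = zero}  []      _  _ = []
fromValues {m = suc m} (x ∷ l) eq b =
  fromℕ< (b 0 z<s) ∷ fromValues l (suc-injective eq) (λ i p → b (suc i) (s<s p))

values-fromValues : ∀ {n m} (l : List ℕ) (eq : length l ≡ m) (b : Bounded l n) → values (fromValues l eq b) ≡ l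
values-fromValues {m = zero}  []      _  _ = refl
values-fromValues {m = suc m} (x ∷ l) eq b =
  cong₂ _∷_ (toℕ-fromℕ< (b 0 z<s)) (values-fromValues l (suc-injective eq) (λ i p → b (suc i) (s<s p)))

allVecs-complete : ∀ {A : Set} (xs : List A) → (∀ x → x ∈ xs) → ∀ m (v : Vec A m) → v ∈ allVecs xs m
allVecs-complete xs complete zero    []      = here refl
allVecs-complete xs complete (suc m) (x ∷ v) =
  ∈-concatMap⁺ (λ y → map (y ∷_) (allVecs xs m))
    (Any.map (λ { refl → ∈-map⁺ (x ∷_) (allVecs-complete xs complete m v) }) (complete x))

allVecs-unique : ∀ {A : Set} (xs : List A) → Unique xs → ∀ m → Unique (allVecs xs m)
allVecs-unique xs unique zero    = All.[] AllPairs.∷ AllPairs.[]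
allVecs-unique xs unique (suc m) =
  Unique.concat⁺ (All.map⁺ (All.tabulate (λ _ → Unique.map⁺ Vec.∷-injectiveʳ (allVecs-unique xs unique m))))
                 (AllPairs.map⁺ (AllPairs.map disjoint unique))
  where
  disjoint : ∀ {x y} → x ≢ y → ∀ {v} → v ∈ map (x ∷_) (allVecs xs m) × v ∈ map (y ∷_) (allVecs xs m) → ⊥
  disjoint x≢y (p , q) with ∈-map⁻ _ p | ∈-map⁻ _ q
  ... | _ , _ , refl | _ , _ , eq = x≢y (Vec.∷-injectiveˡ eq)

length-allVecs : ∀ {A : Set} (xs : List A) m → length (allVecs xs m) ≡ length xs ^ m
length-allVecs xs zero    = refl
length-allVecs xs (suc m) = begin
  length (concatMap (λ x → map (x ∷_) (allVecs xs m)) xs) ≡⟨ length-concat-const xs ⟩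
  length xs * length (allVecs xs m)                        ≡⟨ cong (length xs *_) (length-allVecs xs m) ⟩
  length xs * length xs ^ m                                ∎
  where
  open ≡-Reasoning
  length-concat-const : ∀ ys → length (concatMap (λ x → map (x ∷_) (allVecs xs m)) ys) ≡ length ys * length (allVecs xs m)
  length-concat-const []       = refl
  length-concat-const (y ∷ ys) = begin
    length (map (y ∷_) (allVecs xs m) ++ concatMap (λ x → map (x ∷_) (allVecs xs m)) ys)
      ≡⟨ List.length-++ (map (y ∷_) (allVecs xs m)) ⟩
    length (map (y ∷_) (allVecs xs m)) + length (concatMap (λ x → map (x ∷_) (allVecs xs m)) ys)
      ≡⟨ cong₂ _+_ (List.length-map (y ∷_) (allVecs xs m)) (length-concat-const ys) ⟩
    length (allVecs xs m) + length ys * length (allVecs xs m) ∎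

module _ {A : Set} where

  private
    remove : ∀ {x : A} {ys} → x ∈ ys → List A
    remove {ys = _ ∷ ys} (here _)  = ys
    remove {ys = y ∷ ys} (there p) = y ∷ remove p

    length-remove : ∀ {x : A} {ys} (p : x ∈ ys) → length ys ≡ suc (length (remove p))
    length-remove (here _)  = refl
    length-remove (there p) = cong suc (length-remove p)

    ∈-remove : ∀ {x z : A} {ys} (p : x ∈ ys) → z ∈ ys → z ≢ x → z ∈ remove p
    ∈-remove (here refl) (here refl) z≢x = ⊥-elim (z≢x refl)
    ∈-remove (here refl) (there q)   _   = q
    ∈-remove (there p)   (here eq)   _   = here eq
    ∈-remove (there p)   (there q)   z≢x = there (∈-remove p q z≢x)

  unique-⊆⇒length-≤ : ∀ (xs ys : List A) → Unique xs → (∀ {x} → x ∈ xs → x ∈ ys) → length xs ≤ length ys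
  unique-⊆⇒length-≤ []       ys _                       _  = z≤n
  unique-⊆⇒length-≤ (x ∷ xs) ys (x∉xs AllPairs.∷ unique) xs⊆ys =
    subst (suc (length xs) ≤_) (sym (length-remove x∈ys))
      (s≤s (unique-⊆⇒length-≤ xs (remove x∈ys) unique
        (λ z∈xs → ∈-remove x∈ys (xs⊆ys (there z∈xs)) (λ { refl → All.lookup x∉xs z∈xs refl }))))
    where x∈ys = xs⊆ys (here refl)

allMaps-unique : ∀ n → Unique (allMaps n)
allMaps-unique n = allVecs-unique _ (Unique.allFin⁺ n) n

invDes-≥ : ∀ {A : Set} n k (xs : List A) (f : A → Vec (Fin n) n) → Unique xs →
           (∀ {x y} → f x ≡ f y → x ≡ y) → (∀ x → HasInvDes n k (f x)) → length xs ≤ invDes n k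
invDes-≥ n k xs f unique f-injective has = subst (_≤ invDes n k) (List.length-map f xs)
  (unique-⊆⇒length-≤ (map f xs) _ (Unique.map⁺ f-injective unique)
    (λ σ∈ → let (x , _ , σ≡fx) = ∈-map⁻ f σ∈ in
      ∈-filter⁺ (hasInvDes? n k) (allVecs-complete _ ∈-allFin n _) (subst (HasInvDes n k) (sym σ≡fx) (has x))))

invDes-≤ : ∀ {A : Set} n k (xs : List A) (g : A → List ℕ) →
           (∀ σ → HasInvDes n k σ → ∃[ x ] x ∈ xs × values σ ≡ g x) → invDes n k ≤ length xs
invDes-≤ n k xs g covered = begin
  invDes n k                                        ≡⟨ sym (List.length-map values (filter (hasInvDes? n k) (allMaps n))) ⟩
  length (map values (filter (hasInvDes? n k) (allMaps n))) ≤⟨ unique-⊆⇒length-≤ _ (map g xs) unique ⊆-codes ⟩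
  length (map g xs)                                 ≡⟨ List.length-map g xs ⟩
  length xs                                         ∎
  where
  open ≤-Reasoning
  unique = Unique.map⁺ (values-injective _ _) (Unique.filter⁺ (hasInvDes? n k) (allMaps-unique n))
  ⊆-codes : ∀ {l} → l ∈ map values (filter (hasInvDes? n k) (allMaps n)) → l ∈ map g xs
  ⊆-codes l∈ with ∈-map⁻ values l∈
  ... | σ , σ∈ , refl with covered σ (proj₂ (∈-filter⁻ (hasInvDes? n k) {xs = allMaps n} σ∈))
  ... | x , x∈ , eq = subst (_∈ map g xs) (sym eq) (∈-map⁺ g x∈)

-- Block permutations

run : ℕ → ℕ → List ℕ
run s zero    = []
run s (suc L) = s ∷ run (suc s) L

length-run : ∀ s L → length (run s L) ≡ L
length-run s zero    = refl
length-run s (suc L) = cong suc (length-run (suc s) L)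

nth-run : ∀ s {L t} → t < L → nth (run s L) t ≡ s + t
nth-run s {suc L} {zero}  _       = sym (+-identityʳ s)
nth-run s {suc L} {suc t} (s<s p) = trans (nth-run (suc s) p) (sym (+-suc s t))

descentsℕ-run : ∀ s L → descentsℕ (run s L) ≡ 0
descentsℕ-run s zero          = refl
descentsℕ-run s (suc zero)    = refl
descentsℕ-run s (suc (suc L)) = cong₂ _+_ (isDescent-≤ (n≤1+n s)) (descentsℕ-run (suc s) (suc L))

descentsℕ-run-++ : ∀ s L y l → descentsℕ (run s (suc L) ++ y ∷ l) ≡ isDescent (s + L) y + descentsℕ (y ∷ l)
descentsℕ-run-++ s zero    y l = cong (λ x → isDescent x y + descentsℕ (y ∷ l)) (sym (+-identityʳ s))
descentsℕ-run-++ s (suc L) y l = begin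
  isDescent s (suc s) + descentsℕ (run (suc s) (suc L) ++ y ∷ l)
    ≡⟨ cong₂ _+_ (isDescent-≤ (n≤1+n s)) (descentsℕ-run-++ (suc s) L y l) ⟩
  isDescent (suc s + L) y + descentsℕ (y ∷ l)
    ≡⟨ cong (λ x → isDescent x y + descentsℕ (y ∷ l)) (sym (+-suc s L)) ⟩
  isDescent (s + suc L) y + descentsℕ (y ∷ l) ∎
  where open ≡-Reasoning

descentsℕ-run-++-run : ∀ s {L} s′ {L′} l → 0 < L → 0 < L′ →
  descentsℕ (run s L ++ (run s′ L′ ++ l)) ≡ isDescent (s + pred L) s′ + descentsℕ (run s′ L′ ++ l)
descentsℕ-run-++-run s {suc L} s′ {suc L′} l _ _ = descentsℕ-run-++ s L s′ (run (suc s′) L′ ++ l)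

offset : List ℕ → ℕ → ℕ
offset ls       zero    = 0
offset []       (suc k) = 0
offset (L ∷ ls) (suc k) = L + offset ls k

offset-suc : ∀ ls k → offset ls (suc k) ≡ offset ls k + nth ls k
offset-suc []       zero    = refl
offset-suc []       (suc k) = refl
offset-suc (L ∷ ls) zero    = +-comm L 0
offset-suc (L ∷ ls) (suc k) = trans (cong (L +_) (offset-suc ls k)) (sym (+-assoc L _ _))

offset-monotone : ∀ ls {j k} → j ≤ k → offset ls j ≤ offset ls k
offset-monotone ls {k = zero}  z≤n = z≤n
offset-monotone ls {j} {suc k} j≤1+k with m≤n⇒m<n∨m≡n j≤1+k
... | inj₂ refl = ≤-refl
... | inj₁ j<1+k = ≤-trans (offset-monotone ls (s≤s⁻¹ j<1+k))
                     (subst (offset ls k ≤_) (sym (offset-suc ls k)) (m≤m+n _ _))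

offset-< : ∀ ls {j k} → j < k → offset ls j + nth ls j ≤ offset ls k
offset-< ls {j} j<k = subst (_≤ _) (offset-suc ls j) (offset-monotone ls j<k)

offset+<sum : ∀ ls {j t} → t < nth ls j → offset ls j + t < sum ls
offset+<sum (L ∷ ls) {zero}      t<L = <-≤-trans t<L (m≤m+n L (sum ls))
offset+<sum (L ∷ ls) {suc j} {t} t<  =
  subst (_< L + sum ls) (sym (+-assoc L _ t)) (+-monoʳ-< L (offset+<sum ls t<))

offset-decompose : ∀ ls {i} → i < sum ls → ∃[ j ] ∃[ t ] t < nth ls j × i ≡ offset ls j + t
offset-decompose (L ∷ ls) {i} i< with i <? L
... | yes i<L = 0 , i , i<L , refl
... | no  i≮L with offset-decompose ls {i ∸ L} (+-cancelˡ-< L _ _ (subst (_< L + sum ls) (sym (m+[n∸m]≡n (≮⇒≥ i≮L))) i<))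
... | j , t , t< , eq = suc j , t , t< , (begin
  i                     ≡⟨ sym (m+[n∸m]≡n (≮⇒≥ i≮L)) ⟩
  L + (i ∸ L)           ≡⟨ cong (L +_) eq ⟩
  L + (offset ls j + t) ≡⟨ sym (+-assoc L _ t) ⟩
  L + offset ls j + t   ∎)
  where open ≡-Reasoning

-- The one-line notation of the permutation that lays out, in the order `ord`, the blocks of
-- lengths `ls`, each block kept increasing.
blocks : List ℕ → List ℕ → List ℕ
blocks ls []        = []
blocks ls (k ∷ ord) = run (offset ls k) (nth ls k) ++ blocks ls ord

length-blocks : ∀ ls ord → length (blocks ls ord) ≡ sum (map (nth ls) ord)
length-blocks ls []        = refl
length-blocks ls (k ∷ ord) =
  trans (List.length-++ (run (offset ls k) (nth ls k))) (cong₂ _+_ (length-run _ _) (length-blocks ls ord))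

nth-blocks : ∀ ls ord {j t} → j < length ord → t < nth ls (nth ord j) →
             nth (blocks ls ord) (offset (map (nth ls) ord) j + t) ≡ offset ls (nth ord j) + t
nth-blocks ls (k ∷ ord) {zero}      _       t< =
  trans (nth-++ˡ (run (offset ls k) (nth ls k)) _ (subst (_ <_) (sym (length-run _ _)) t<)) (nth-run _ t<)
nth-blocks ls (k ∷ ord) {suc j} {t} (s<s p) t< = begin
  nth (blocks ls (k ∷ ord)) (nth ls k + offset (map (nth ls) ord) j + t)
    ≡⟨ cong (nth (blocks ls (k ∷ ord))) (trans (+-assoc (nth ls k) _ t)
         (cong (_+ (offset (map (nth ls) ord) j + t)) (sym (length-run (offset ls k) (nth ls k))))) ⟩
  nth (blocks ls (k ∷ ord)) (length (run (offset ls k) (nth ls k)) + (offset (map (nth ls) ord) j + t))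
    ≡⟨ nth-++ʳ (run (offset ls k) (nth ls k)) _ _ ⟩
  nth (blocks ls ord) (offset (map (nth ls) ord) j + t)
    ≡⟨ nth-blocks ls ord p t< ⟩
  offset ls (nth ord j) + t ∎
  where open ≡-Reasoning

isDescent-offsets : ∀ ls {k k′} → All (0 <_) ls → k′ < length ls → k ≢ k′ →
                    isDescent (offset ls k + pred (nth ls k)) (offset ls k′) ≡ isDescent k k′
isDescent-offsets ls {k} {k′} positive k′< k≢k′ with <-cmp k k′
... | tri< k<k′ _ _ = trans (isDescent-≤ (≤-trans (+-monoʳ-≤ (offset ls k) pred[n]≤n) (offset-< ls k<k′)))
                            (sym (isDescent-≤ (<⇒≤ k<k′)))
... | tri≈ _ k≡k′ _ = ⊥-elim (k≢k′ k≡k′)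
... | tri> _ _ k′<k = trans (isDescent-> (<-≤-trans (m<m+n (offset ls k′) (nth-All positive k′<))
                                                    (≤-trans (offset-< ls k′<k) (m≤m+n _ _))))
                            (sym (isDescent-> k′<k))

descents-blocks : ∀ ls ord → All (0 <_) ls → Bounded ord (length ls) →
                  (∀ j → suc j < length ord → nth ord j ≢ nth ord (suc j)) →
                  descentsℕ (blocks ls ord) ≡ descentsℕ ord
descents-blocks ls []             _        _       _        = refl
descents-blocks ls (k ∷ [])       _        _       _        =
  trans (cong descentsℕ (List.++-identityʳ (run (offset ls k) (nth ls k)))) (descentsℕ-run (offset ls k) (nth ls k))
descents-blocks ls (k ∷ k′ ∷ ord) positive bounded distinct = begin
  descentsℕ (run (offset ls k) (nth ls k) ++ blocks ls (k′ ∷ ord))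
    ≡⟨ descentsℕ-run-++-run (offset ls k) (offset ls k′) (blocks ls ord) (nth-All positive k<) (nth-All positive k′<) ⟩
  isDescent (offset ls k + pred (nth ls k)) (offset ls k′) + descentsℕ (blocks ls (k′ ∷ ord))
    ≡⟨ cong₂ _+_ (isDescent-offsets ls positive k′< (distinct 0 (s<s z<s)))
                 (descents-blocks ls (k′ ∷ ord) positive (λ j p → bounded (suc j) (s<s p)) (λ j p → distinct (suc j) (s<s p))) ⟩
  isDescent k k′ + descentsℕ (k′ ∷ ord) ∎
  where
  open ≡-Reasoning
  k<  = bounded 0 z<s
  k′< = bounded 1 (s<s z<s)

-- If `ord` is an involution of the block indices exchanging only blocks of equal length, then
-- `blocks ls ord` is an involution, and (for nonempty blocks) it has the descents of `ord`.
module BlockInvolution (ls ord : List ℕ) (ord-bounded : Bounded ord (length ord))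
                       (ord-involutive : Involutive ord) (preserves-lengths : map (nth ls) ord ≡ ls) where

  length-ord : length ord ≡ length ls
  length-ord = trans (sym (List.length-map (nth ls) ord)) (cong length preserves-lengths)

  ord-bounded-ls : Bounded ord (length ls)
  ord-bounded-ls j j< = subst (nth ord j <_) length-ord (ord-bounded j j<)

  length-partner : ∀ {j} → j < length ls → nth ls (nth ord j) ≡ nth ls j
  length-partner {j} j< = trans (sym (nth-map (nth ls) ord (subst (j <_) (sym length-ord) j<)))
                                (cong (λ l → nth l j) preserves-lengths)

  <length-partner : ∀ {j t} → t < nth ls j → t < nth ls (nth ord j)
  <length-partner {t = t} t< = subst (t <_) (sym (length-partner (<nth⇒<length ls t<))) t<

  length-blocks-sum : length (blocks ls ord) ≡ sum ls
  length-blocks-sum = trans (length-blocks ls ord) (cong sum preserves-lengths)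

  blocks-offset : ∀ {j t} → t < nth ls j → nth (blocks ls ord) (offset ls j + t) ≡ offset ls (nth ord j) + t
  blocks-offset {j} {t} t< =
    subst (λ l → nth (blocks ls ord) (offset l j + t) ≡ offset ls (nth ord j) + t) preserves-lengths
      (nth-blocks ls ord (subst (j <_) (sym length-ord) (<nth⇒<length ls t<)) (<length-partner t<))

  blocks-bounded : Bounded (blocks ls ord) (sum ls)
  blocks-bounded i i< with offset-decompose ls (subst (i <_) length-blocks-sum i<)
  ... | j , t , t< , refl = subst (_< sum ls) (sym (blocks-offset t<)) (offset+<sum ls (<length-partner t<))

  blocks-involutive : Involutive (blocks ls ord)
  blocks-involutive i i< with offset-decompose ls (subst (i <_) length-blocks-sum i<)
  ... | j , t , t< , refl = begin
    nth (blocks ls ord) (nth (blocks ls ord) (offset ls j + t)) ≡⟨ cong (nth (blocks ls ord)) (blocks-offset t<) ⟩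
    nth (blocks ls ord) (offset ls (nth ord j) + t)             ≡⟨ blocks-offset (<length-partner t<) ⟩
    offset ls (nth ord (nth ord j)) + t                         ≡⟨ cong (λ k → offset ls k + t) (ord-involutive j j<) ⟩
    offset ls j + t                                             ∎
    where
    open ≡-Reasoning
    j< = subst (j <_) (sym length-ord) (<nth⇒<length ls t<)

  descents-blocks-ord : All (0 <_) ls → descentsℕ (blocks ls ord) ≡ descentsℕ ord
  descents-blocks-ord positive = descents-blocks ls ord positive ord-bounded-ls distinct
    where
    distinct : ∀ j → suc j < length ord → nth ord j ≢ nth ord (suc j)
    distinct j p eq = 1+n≢n (sym (begin
      j                               ≡⟨ sym (ord-involutive j (<-trans (n<1+n j) p)) ⟩
      nth ord (nth ord j)             ≡⟨ cong (nth ord) eq ⟩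
      nth ord (nth ord (suc j))       ≡⟨ ord-involutive (suc j) p ⟩
      suc j                           ∎))
      where open ≡-Reasoning

-- Involutions with one descent

descentsℕ≡0⇒ascending : ∀ l → descentsℕ l ≡ 0 → ∀ i → suc i < length l → nth l i ≤ nth l (suc i)
descentsℕ≡0⇒ascending (x ∷ [])    _  _       (s<s ())
descentsℕ≡0⇒ascending (x ∷ y ∷ l) eq zero    _       = isDescent≡0⇒≤ (m+n≡0⇒m≡0 _ eq)
descentsℕ≡0⇒ascending (x ∷ y ∷ l) eq (suc i) (s<s p) = descentsℕ≡0⇒ascending (y ∷ l) (m+n≡0⇒n≡0 (isDescent x y) eq) i p

descentsℕ≡1⇒single-descent : ∀ l → descentsℕ l ≡ 1 →
  ∃[ d ] suc d < length l × nth l (suc d) < nth l d × (∀ i → suc i < length l → i ≢ d → nth l i ≤ nth l (suc i))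
descentsℕ≡1⇒single-descent (x ∷ y ∷ l) eq with y <? x | descentsℕ≡1⇒single-descent (y ∷ l)
... | yes y<x | _ = 0 , s<s z<s , y<x , λ
  { zero    _       0≢0 → ⊥-elim (0≢0 refl)
  ; (suc i) (s<s p) _   → descentsℕ≡0⇒ascending (y ∷ l) rest i p }
  where rest = suc-injective (trans (cong (_+ descentsℕ (y ∷ l)) (sym (isDescent-> y<x))) eq)
... | no y≮x | single-descent with single-descent (trans (cong (_+ descentsℕ (y ∷ l)) (sym (isDescent-≤ (≮⇒≥ y≮x)))) eq)
... | d , d< , descent , ascending = suc d , s<s d< , descent , λ
  { zero    _       _   → ≮⇒≥ y≮x
  ; (suc i) (s<s p) i≢d → ascending i p (i≢d ∘ cong suc) }

stepwise⇒increasing : ∀ (h : ℕ → ℕ) lo {i j} → (∀ k → lo ≤ k → suc k ≤ j → h k < h (suc k)) →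
                      lo ≤ i → i < j → h i < h j
stepwise⇒increasing h lo {i} {suc j} step lo≤i (s≤s i≤j) with m≤n⇒m<n∨m≡n i≤j
... | inj₂ refl = step i lo≤i ≤-refl
... | inj₁ i<j  = <-trans (stepwise⇒increasing h lo (λ k p q → step k p (m≤n⇒m≤1+n q)) lo≤i i<j)
                          (step j (≤-trans lo≤i (<⇒≤ i<j)) ≤-refl)

swapOrder : List ℕ
swapOrder = 0 ∷ 2 ∷ 1 ∷ 3 ∷ []

swapOrder-bounded : Bounded swapOrder (length swapOrder)
swapOrder-bounded = all-below (from-yes (All.all? (λ i → nth swapOrder i <? 4) (List.upTo 4)))

swapOrder-involutive : Involutive swapOrder
swapOrder-involutive = all-below (from-yes (All.all? (λ i → nth swapOrder (nth swapOrder i) ≟ i) (List.upTo 4)))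

swapPattern : ℕ → ℕ → ℕ → List ℕ
swapPattern n a m = blocks (a ∷ m ∷ m ∷ n ∸ (a + m + m) ∷ []) swapOrder

module OneDescentInvolution
  (l : List ℕ) (bounded : Bounded l (length l)) (involutive : Involutive l)
  (d : ℕ) (d+1<n : suc d < length l) (descent : nth l (suc d) < nth l d)
  (ascending : ∀ i → suc i < length l → i ≢ d → nth l i ≤ nth l (suc i)) where

  n r a m : ℕ
  n = length l
  r = suc d
  a = nth l r
  m = r ∸ a

  h : ℕ → ℕ
  h = nth l

  strictly-ascending : ∀ i → suc i < n → i ≢ d → h i < h (suc i)
  strictly-ascending i p i≢d = ≤∧≢⇒< (ascending i p i≢d) λ eq → 1+n≢n (sym (begin
    i           ≡⟨ sym (involutive i (<-trans (n<1+n i) p)) ⟩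
    h (h i)     ≡⟨ cong h eq ⟩
    h (h (suc i)) ≡⟨ involutive (suc i) p ⟩
    suc i       ∎))
    where open ≡-Reasoning

  increasing-below : ∀ {i j} → i < j → j ≤ d → h i < h j
  increasing-below {j = j} i<j j≤d = stepwise⇒increasing h 0
    (λ k _ k<j → strictly-ascending k (<-trans (s≤s (≤-trans k<j j≤d)) d+1<n) (λ k≡d → <-irrefl k≡d (≤-trans k<j j≤d)))
    z≤n i<j

  increasing-above : ∀ {i j} → r ≤ i → i < j → j < n → h i < h j
  increasing-above {j = j} r≤i i<j j<n = stepwise⇒increasing h r
    (λ k r≤k k<j → strictly-ascending k (≤-<-trans k<j j<n) (λ { refl → <-irrefl refl r≤k }))
    r≤i i<j

  nondecreasing-above : ∀ {i j} → r ≤ i → i ≤ j → j < n → h i ≤ h j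
  nondecreasing-above r≤i i≤j j<n with m≤n⇒m<n∨m≡n i≤j
  ... | inj₁ i<j  = <⇒≤ (increasing-above r≤i i<j j<n)
  ... | inj₂ refl = ≤-refl

  r<n : r < n
  r<n = d+1<n

  a<n : a < n
  a<n = bounded r r<n

  h-a : h a ≡ r
  h-a = involutive r r<n

  a<r : a < r
  a<r with <-cmp a r
  ... | tri< a<r _ _ = a<r
  ... | tri≈ _ a≡r _ = ⊥-elim (<-asym (n<1+n d) (subst₂ _<_ a≡r (involutive d d<n)
                          (increasing-above ≤-refl (subst (_< h d) a≡r descent) (bounded d d<n))))
    where d<n = <-trans (n<1+n d) r<n
  ... | tri> _ _ r<a = ⊥-elim (<-asym (increasing-above ≤-refl r<a a<n) (subst (_< a) (sym h-a) r<a))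

  a+m≡r : a + m ≡ r
  a+m≡r = m+[n∸m]≡n (<⇒≤ a<r)

  -- i < a forces h i < r (else i = h (h i) ≥ h r = a), and on the increasing run [0, r)
  -- an involution fixes i, by strong induction.
  fixed-below : ∀ i → i < a → h i ≡ i
  fixed-below = <-rec (λ i → i < a → h i ≡ i) step
    where
    step : ∀ i → (∀ {j} → j < i → j < a → h j ≡ j) → i < a → h i ≡ i
    step i rec i<a with r ≤? h i | <-cmp (h i) i
    ... | yes r≤hi | _ = ⊥-elim (<⇒≱ i<a (subst (a ≤_) (involutive i i<n) (a≤ (bounded i i<n))))
      where
      i<n = <-trans i<a a<n
      a≤ : h i < n → a ≤ h (h i)
      a≤ = nondecreasing-above ≤-refl r≤hi
    ... | no _ | tri< hi<i _ _ = ⊥-elim (<⇒≢ hi<i (trans (sym (rec hi<i (<-trans hi<i i<a))) (involutive i (<-trans i<a a<n))))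
    ... | no _ | tri≈ _ hi≡i _ = hi≡i
    ... | no r≰hi | tri> _ _ i<hi = ⊥-elim (<-asym i<hi (subst (h i <_) (involutive i (<-trans i<a a<n))
                                      (increasing-below i<hi (s≤s⁻¹ (≰⇒> r≰hi)))))

  -- w = h (a + t + 1) exceeds h a = r, cannot be ≤ r + t by monotonicity on [r, n), and
  -- w > r + t + 1 would put h (r + t + 1) strictly between a + t and a + t + 1.
  swapped : ∀ t → t < m → r + t < n × h (r + t) ≡ a + t
  swapped zero    _       = subst (_< n) (sym (+-identityʳ r)) r<n , trans (cong h (+-identityʳ r)) (sym (+-identityʳ a))
  swapped (suc t) t+1<m = r+t+1<n , h-r+t+1
    where
    previous = swapped t (<-trans (n<1+n t) t+1<m)
    r+t<n = proj₁ previous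
    h-r+t = proj₂ previous
    v = a + suc t
    a+t<v : a + t < v
    a+t<v = subst (a + t <_) (sym (+-suc a t)) (n<1+n (a + t))
    v<r : v < r
    v<r = subst (v <_) a+m≡r (+-monoʳ-< a t+1<m)
    v<n = <-trans v<r r<n
    w = h v
    w<n = bounded v v<n
    h-w : h w ≡ v
    h-w = involutive v v<n
    r<w : r < w
    r<w = subst (_< w) h-a (increasing-below (m<m+n a z<s) (s≤s⁻¹ v<r))
    r+t<w : r + t < w
    r+t<w = ≰⇒> λ w≤r+t → <⇒≱ a+t<v (subst₂ _≤_ h-w h-r+t (nondecreasing-above (<⇒≤ r<w) w≤r+t r+t<n))
    r+t+1≤w : r + suc t ≤ w
    r+t+1≤w = subst (_≤ w) (sym (+-suc r t)) r+t<w
    r+t+1<n = ≤-<-trans r+t+1≤w w<n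
    v≤ : v ≤ h (r + suc t)
    v≤ = subst₂ _≤_ (sym (+-suc a t)) refl (subst (_< h (r + suc t)) h-r+t
           (increasing-above (m≤m+n r t) (subst (r + t <_) (sym (+-suc r t)) (n<1+n (r + t))) r+t+1<n))
    h-r+t+1 : h (r + suc t) ≡ v
    h-r+t+1 with m≤n⇒m<n∨m≡n r+t+1≤w
    ... | inj₂ eq = trans (cong h eq) h-w
    ... | inj₁ lt = ⊥-elim (<⇒≱ (subst (h (r + suc t) <_) h-w (increasing-above (m≤m+n r (suc t)) lt w<n)) v≤)

  swapped-back : ∀ t → t < m → h (a + t) ≡ r + t
  swapped-back t t<m = trans (cong h (sym (proj₂ (swapped t t<m)))) (involutive (r + t) (proj₁ (swapped t t<m)))

  r+m≤n : r + m ≤ n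
  r+m≤n = last (m<n⇒0<n∸m a<r) (λ t t<m → proj₁ (swapped t t<m))
    where
    last : ∀ {k} → 0 < k → (∀ t → t < k → r + t < n) → r + k ≤ n
    last {suc k} _ below = subst (_≤ n) (sym (+-suc r k)) (below k ≤-refl)

  below-r+m-closed : ∀ {j} → j < r + m → h j < r + m
  below-r+m-closed {j} j< with j <? a | j <? r
  ... | yes j<a | _       = subst (_< r + m) (sym (fixed-below j j<a)) j<
  ... | no j≮a  | yes j<r = subst (_< r + m) (sym h-j) (+-monoʳ-< r t<m)
    where
    t = j ∸ a
    j≡a+t = sym (m+[n∸m]≡n (≮⇒≥ j≮a))
    t<m : t < m
    t<m = +-cancelˡ-< a t m (subst₂ _<_ j≡a+t (sym a+m≡r) j<r)
    h-j : h j ≡ r + t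
    h-j = trans (cong h j≡a+t) (swapped-back t t<m)
  ... | no _    | no j≮r  = subst (_< r + m) (sym h-j) (<-≤-trans (subst (a + t <_) a+m≡r (+-monoʳ-< a t<m)) (m≤m+n r m))
    where
    t = j ∸ r
    j≡r+t = sym (m+[n∸m]≡n (≮⇒≥ j≮r))
    t<m : t < m
    t<m = +-cancelˡ-< r t m (subst (_< r + m) j≡r+t j<)
    h-j : h j ≡ a + t
    h-j = trans (cong h j≡r+t) (proj₂ (swapped t t<m))

  -- [0, r + m) is closed under h, so h i ≥ r + m, and the increasing run [r, n) fixes i.
  fixed-above : ∀ i → r + m ≤ i → i < n → h i ≡ i
  fixed-above = <-rec (λ i → r + m ≤ i → i < n → h i ≡ i) step
    where
    step : ∀ i → (∀ {j} → j < i → r + m ≤ j → j < n → h j ≡ j) → r + m ≤ i → i < n → h i ≡ i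
    step i rec r+m≤i i<n with h i <? r + m | <-cmp (h i) i
    ... | yes hi< | _ = ⊥-elim (<⇒≱ (subst (_< r + m) (involutive i i<n) (below-r+m-closed hi<)) r+m≤i)
    ... | no hi≮ | tri< hi<i _ _ = ⊥-elim (<⇒≢ hi<i (trans (sym (rec hi<i (≮⇒≥ hi≮) (bounded i i<n))) (involutive i i<n)))
    ... | no _   | tri≈ _ hi≡i _ = hi≡i
    ... | no _   | tri> _ _ i<hi = ⊥-elim (<-asym i<hi (subst (h i <_) (involutive i i<n)
                                     (increasing-above (≤-trans (m≤m+n r m) r+m≤i) i<hi (bounded i i<n))))

  layout : List ℕ
  layout = a ∷ m ∷ m ∷ n ∸ (a + m + m) ∷ []

  open BlockInvolution layout swapOrder swapOrder-bounded swapOrder-involutive refl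

  offset₁ : offset layout 1 ≡ a
  offset₁ = +-identityʳ a

  offset₂ : offset layout 2 ≡ r
  offset₂ = trans (cong (a +_) (+-identityʳ m)) a+m≡r

  offset₃ : offset layout 3 ≡ r + m
  offset₃ = trans (cong (λ x → a + (m + x)) (+-identityʳ m)) (trans (sym (+-assoc a m m)) (cong (_+ m) a+m≡r))

  sum-layout : sum layout ≡ n
  sum-layout = begin
    a + (m + (m + (n ∸ (a + m + m) + 0))) ≡⟨ cong (λ x → a + (m + (m + x))) (+-identityʳ _) ⟩
    a + (m + (m + (n ∸ (a + m + m))))     ≡⟨ sym (trans (+-assoc (a + m) m _) (+-assoc a m _)) ⟩
    a + m + m + (n ∸ (a + m + m))         ≡⟨ m+[n∸m]≡n (subst (_≤ n) (cong (_+ m) (sym a+m≡r)) r+m≤n) ⟩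
    n                                     ∎
    where open ≡-Reasoning

  shape-at : ∀ j {t} → t < nth layout j → offset layout j + t < n → h (offset layout j + t) ≡ offset layout (nth swapOrder j) + t
  shape-at 0 {t} t< _ = fixed-below t t<
  shape-at 1 {t} t< _ = begin
    h (offset layout 1 + t) ≡⟨ cong (λ x → h (x + t)) offset₁ ⟩
    h (a + t)           ≡⟨ swapped-back t t< ⟩
    r + t               ≡⟨ cong (_+ t) (sym offset₂) ⟩
    offset layout 2 + t     ∎
    where open ≡-Reasoning
  shape-at 2 {t} t< _ = begin
    h (offset layout 2 + t) ≡⟨ cong (λ x → h (x + t)) offset₂ ⟩
    h (r + t)           ≡⟨ proj₂ (swapped t t<) ⟩
    a + t               ≡⟨ cong (_+ t) (sym offset₁) ⟩
    offset layout 1 + t     ∎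
    where open ≡-Reasoning
  shape-at 3 {t} _ <n = fixed-above (offset layout 3 + t) (subst (_≤ offset layout 3 + t) offset₃ (m≤m+n _ t)) <n
  shape-at (suc (suc (suc (suc j)))) ()

  shape : l ≡ swapPattern n a m
  shape = nth-extensional l (blocks layout swapOrder) (sym (trans length-blocks-sum sum-layout)) agree
    where
    agree : ∀ i → i < n → h i ≡ nth (blocks layout swapOrder) i
    agree i i<n with offset-decompose layout (subst (i <_) (sym sum-layout) i<n)
    ... | j , t , t< , refl = trans (shape-at j t< i<n) (sym (blocks-offset {j} t<))

involution-with-one-descent : ∀ l → Bounded l (length l) → Involutive l → descentsℕ l ≡ 1 →
  ∃[ a ] ∃[ m ] a < length l × m < length l × l ≡ swapPattern (length l) a m
involution-with-one-descent l bounded involutive one with descentsℕ≡1⇒single-descent l one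
... | d , d< , descent , ascending = a , m , a<n , ≤-<-trans (m∸n≤m r a) r<n , shape
  where open OneDescentInvolution l bounded involutive d d< descent ascending

invDes-1-≤ : ∀ n → invDes n 1 ≤ n ^ 2
invDes-1-≤ n = subst (invDes n 1 ≤_) length-codes (invDes-≤ n 1 (allVecs (List.allFin n) 2) swapPatternOf covered)
  where
  swapPatternOf : Vec (Fin n) 2 → List ℕ
  swapPatternOf (a ∷ m ∷ []) = swapPattern n (toℕ a) (toℕ m)
  length-codes : length (allVecs (List.allFin n) 2) ≡ n ^ 2
  length-codes = trans (length-allVecs (List.allFin n) 2) (cong (_^ 2) (List.length-tabulate {n = n} (λ i → i)))
  covered : ∀ σ → HasInvDes n 1 σ → ∃[ x ] x ∈ allVecs (List.allFin n) 2 × values σ ≡ swapPatternOf x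
  covered σ (involution , one)
    with involution-with-one-descent (values σ)
           (subst (Bounded (values σ)) (sym (length-values σ)) (values-bounded σ))
           (isInvolution⇒involutive σ involution)
           (trans (sym (descents-values σ)) one)
  ... | a , m , a< , m< , eq = fromℕ< a<n ∷ fromℕ< m<n ∷ [] , allVecs-complete _ ∈-allFin 2 _ ,
    trans eq (trans (cong (λ k → swapPattern k a m) (length-values σ))
                    (sym (cong₂ (swapPattern n) (toℕ-fromℕ< a<n) (toℕ-fromℕ< m<n))))
    where
    a<n = subst (a <_) (length-values σ) a<
    m<n = subst (m <_) (length-values σ) m<

-- A five-parameter family of involutions with two descents

crossOrder : List ℕ
crossOrder = 0 ∷ 3 ∷ 6 ∷ 1 ∷ 4 ∷ 7 ∷ 2 ∷ 5 ∷ 8 ∷ []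

crossOrder-bounded : Bounded crossOrder (length crossOrder)
crossOrder-bounded = all-below (from-yes (All.all? (λ i → nth crossOrder i <? 9) (List.upTo 9)))

crossOrder-involutive : Involutive crossOrder
crossOrder-involutive = all-below (from-yes (All.all? (λ i → nth crossOrder (nth crossOrder i) ≟ i) (List.upTo 9)))

crossLayout : ℕ → ℕ → ℕ → ℕ → ℕ → ℕ → List ℕ
crossLayout a b x y z c = a ∷ x ∷ y ∷ x ∷ b ∷ z ∷ y ∷ z ∷ c ∷ []

crossPattern : ℕ → ℕ → ℕ → ℕ → ℕ → ℕ → List ℕ
crossPattern a b x y z c = blocks (crossLayout a b x y z c) crossOrder

module CrossPattern (a b x y z c : ℕ) =
  BlockInvolution (crossLayout a b x y z c) crossOrder crossOrder-bounded crossOrder-involutive refl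

-- Each step reads both patterns at one position lying in different blocks of the two layouts.
module CrossComparison (a b x y z c a′ b′ x′ y′ z′ c′ : ℕ)
  (same : crossPattern (suc a) (suc b) (suc x) (suc y) (suc z) c ≡ crossPattern (suc a′) (suc b′) (suc x′) (suc y′) (suc z′) c′) where

  private
    ls ls′ : List ℕ
    ls  = crossLayout (suc a) (suc b) (suc x) (suc y) (suc z) c
    ls′ = crossLayout (suc a′) (suc b′) (suc x′) (suc y′) (suc z′) c′

    values-agree : ∀ j {t} j′ {t′} → t < nth ls j → t′ < nth ls′ j′ → offset ls j + t ≡ offset ls′ j′ + t′ →
                   offset ls (nth crossOrder j) + t ≡ offset ls′ (nth crossOrder j′) + t′
    values-agree j j′ t< t′< position =
      trans (sym (CrossPattern.blocks-offset (suc a) (suc b) (suc x) (suc y) (suc z) c {j} t<))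
            (trans (cong₂ nth same position)
                   (CrossPattern.blocks-offset (suc a′) (suc b′) (suc x′) (suc y′) (suc z′) c′ {j′} t′<))

  ≮a : ¬ a < a′
  ≮a a<a′ = m+1+n≢m (suc a) (trans (e₁ a x y) (values-agree 1 0 z<s (s<s a<a′) (e₂ a)))
    where
    e₁ : ∀ a x y → suc a + suc (x + suc y) ≡ suc a + (suc x + (suc y + 0)) + 0
    e₁ = solve-∀
    e₂ : ∀ a → suc a + 0 + 0 ≡ suc a
    e₂ = solve-∀

  x+y≡ : a ≡ a′ → x + y ≡ x′ + y′
  x+y≡ refl = +-cancelˡ-≡ (3 + a) (x + y) (x′ + y′) (trans (e₁ a x y) (trans (values-agree 1 1 z<s z<s refl) (e₂ a x′ y′)))
    where
    e₁ : ∀ a x y → 3 + a + (x + y) ≡ suc a + (suc x + (suc y + 0)) + 0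
    e₁ = solve-∀
    e₂ : ∀ a x′ y′ → suc a + (suc x′ + (suc y′ + 0)) + 0 ≡ 3 + a + (x′ + y′)
    e₂ = solve-∀

  ≮x : a ≡ a′ → x + y ≡ x′ + y′ → ¬ x < x′
  ≮x refl x+y≡x′+y′ x<x′ = m+1+n≢m (suc a + (suc x′ + (suc y′ + 0)) + suc x) (begin
    suc a + (suc x′ + (suc y′ + 0)) + suc x + suc (suc (b + z))     ≡⟨ e₁ a x b z x′ y′ ⟩
    6 + a + x + b + z + (x′ + y′)                                   ≡⟨ cong (6 + a + x + b + z +_) (sym x+y≡x′+y′) ⟩
    6 + a + x + b + z + (x + y)                                     ≡⟨ e₂ a x y b z ⟩
    suc a + (suc x + (suc y + (suc x + (suc b + (suc z + 0))))) + 0 ≡⟨ values-agree 2 1 z<s (s<s x<x′) (e₃ a x) ⟩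
    suc a + (suc x′ + (suc y′ + 0)) + suc x                         ∎)
    where
    open ≡-Reasoning
    e₁ : ∀ a x b z x′ y′ → suc a + (suc x′ + (suc y′ + 0)) + suc x + suc (suc (b + z)) ≡ 6 + a + x + b + z + (x′ + y′)
    e₁ = solve-∀
    e₂ : ∀ a x y b z → 6 + a + x + b + z + (x + y) ≡ suc a + (suc x + (suc y + (suc x + (suc b + (suc z + 0))))) + 0
    e₂ = solve-∀
    e₃ : ∀ a x → suc a + (suc x + 0) + 0 ≡ suc a + 0 + suc x
    e₃ = solve-∀

  ≮b : a ≡ a′ → x ≡ x′ → y ≡ y′ → ¬ b < b′
  ≮b refl refl refl b<b′ = m+1+n≢m (suc a + (suc x + (suc y + (suc x + 0))) + suc b)
    (trans (e₁ a x y b z) (values-agree 5 4 z<s (s<s b<b′) (e₂ a x y b)))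
    where
    e₁ : ∀ a x y b z → suc a + (suc x + (suc y + (suc x + 0))) + suc b + suc (suc (z + y))
         ≡ suc a + (suc x + (suc y + (suc x + (suc b + (suc z + (suc y + 0)))))) + 0
    e₁ = solve-∀
    e₂ : ∀ a x y b → suc a + (suc x + (suc y + (suc x + (suc b + 0)))) + 0 ≡ suc a + (suc x + (suc y + (suc x + 0))) + suc b
    e₂ = solve-∀

  ≮z : a ≡ a′ → x ≡ x′ → y ≡ y′ → b ≡ b′ → ¬ z < z′
  ≮z refl refl refl refl z<z′ = m+1+n≢m (suc a + (suc x + 0) + 0)
    (trans (e₁ a x y b z z′) (sym (values-agree 6 5 z<s (s<s z<z′) (e₂ a x y b z))))
    where
    e₁ : ∀ a x y b z z′ → suc a + (suc x + 0) + 0 + suc (5 + (x + y + y + b + z + z′))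
         ≡ suc a + (suc x + (suc y + (suc x + (suc b + (suc z′ + (suc y + 0)))))) + suc z
    e₁ = solve-∀
    e₂ : ∀ a x y b z → suc a + (suc x + (suc y + (suc x + (suc b + (suc z + 0))))) + 0
                     ≡ suc a + (suc x + (suc y + (suc x + (suc b + 0)))) + suc z
    e₂ = solve-∀

crossPattern-injective : ∀ a b x y z c a′ b′ x′ y′ z′ c′ →
  crossPattern (suc a) (suc b) (suc x) (suc y) (suc z) c ≡ crossPattern (suc a′) (suc b′) (suc x′) (suc y′) (suc z′) c′ →
  a ≡ a′ × b ≡ b′ × x ≡ x′ × y ≡ y′ × z ≡ z′
crossPattern-injective a b x y z c a′ b′ x′ y′ z′ c′ same = a≡a′ , b≡b′ , x≡x′ , y≡y′ , z≡z′
  where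
  module L = CrossComparison a b x y z c a′ b′ x′ y′ z′ c′ same
  module R = CrossComparison a′ b′ x′ y′ z′ c′ a b x y z c (sym same)
  a≡a′ : a ≡ a′
  a≡a′ = ≤-antisym (≮⇒≥ R.≮a) (≮⇒≥ L.≮a)
  x+y≡x′+y′ : x + y ≡ x′ + y′
  x+y≡x′+y′ = L.x+y≡ a≡a′
  x≡x′ : x ≡ x′
  x≡x′ = ≤-antisym (≮⇒≥ (R.≮x (sym a≡a′) (sym x+y≡x′+y′))) (≮⇒≥ (L.≮x a≡a′ x+y≡x′+y′))
  y≡y′ : y ≡ y′
  y≡y′ = +-cancelˡ-≡ x y y′ (trans x+y≡x′+y′ (cong (_+ y′) (sym x≡x′)))
  b≡b′ : b ≡ b′
  b≡b′ = ≤-antisym (≮⇒≥ (R.≮b (sym a≡a′) (sym x≡x′) (sym y≡y′))) (≮⇒≥ (L.≮b a≡a′ x≡x′ y≡y′))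
  z≡z′ : z ≡ z′
  z≡z′ = ≤-antisym (≮⇒≥ (R.≮z (sym a≡a′) (sym x≡x′) (sym y≡y′) (sym b≡b′))) (≮⇒≥ (L.≮z a≡a′ x≡x′ y≡y′ b≡b′))

sum-crossLayout : ∀ a b x y z c → sum (crossLayout a b x y z c) ≡ sum (crossLayout a b x y z 0) + c
sum-crossLayout = normalise
  where
  normalise : ∀ a b x y z c → a + (x + (y + (x + (b + (z + (y + (z + (c + 0))))))))
                             ≡ a + (x + (y + (x + (b + (z + (y + (z + 0))))))) + c
  normalise = solve-∀

-- The last block absorbs the remaining length, so that all members have size 8p + 1.
crossLayoutOf : ∀ p → Vec (Fin p) 5 → List ℕ
crossLayoutOf p (a ∷ b ∷ x ∷ y ∷ z ∷ []) = crossLayout A B X Y Z (suc (8 * p ∸ sum (crossLayout A B X Y Z 0)))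
  where
  A B X Y Z : ℕ
  A = suc (toℕ a)
  B = suc (toℕ b)
  X = suc (toℕ x)
  Y = suc (toℕ y)
  Z = suc (toℕ z)

crossMember : ∀ p → Vec (Fin p) 5 → List ℕ
crossMember p v = blocks (crossLayoutOf p v) crossOrder

module _ (p : ℕ) where

  crossLayoutOf-preserves : ∀ v → map (nth (crossLayoutOf p v)) crossOrder ≡ crossLayoutOf p v
  crossLayoutOf-preserves (a ∷ b ∷ x ∷ y ∷ z ∷ []) = refl

  crossLayoutOf-positive : ∀ v → All (0 <_) (crossLayoutOf p v)
  crossLayoutOf-positive (a ∷ b ∷ x ∷ y ∷ z ∷ []) =
    z<s All.∷ z<s All.∷ z<s All.∷ z<s All.∷ z<s All.∷ z<s All.∷ z<s All.∷ z<s All.∷ z<s All.∷ All.[]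

  crossLayoutOf-sum : ∀ v → sum (crossLayoutOf p v) ≡ suc (8 * p)
  crossLayoutOf-sum (a ∷ b ∷ x ∷ y ∷ z ∷ []) = begin
    sum (crossLayout A B X Y Z (suc (8 * p ∸ Q))) ≡⟨ sum-crossLayout A B X Y Z _ ⟩
    Q + suc (8 * p ∸ Q)                           ≡⟨ +-suc Q _ ⟩
    suc (Q + (8 * p ∸ Q))                         ≡⟨ cong suc (m+[n∸m]≡n Q≤8p) ⟩
    suc (8 * p)                                   ∎
    where
    open ≡-Reasoning
    A B X Y Z Q : ℕ
    A = suc (toℕ a)
    B = suc (toℕ b)
    X = suc (toℕ x)
    Y = suc (toℕ y)
    Z = suc (toℕ z)
    Q = sum (crossLayout A B X Y Z 0)
    Q≤8p : Q ≤ 8 * p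
    Q≤8p = +-mono-≤ (toℕ<n a) (+-mono-≤ (toℕ<n x) (+-mono-≤ (toℕ<n y) (+-mono-≤ (toℕ<n x)
             (+-mono-≤ (toℕ<n b) (+-mono-≤ (toℕ<n z) (+-mono-≤ (toℕ<n y) (+-mono-≤ (toℕ<n z) z≤n)))))))

  module CrossMember (v : Vec (Fin p) 5) =
    BlockInvolution (crossLayoutOf p v) crossOrder crossOrder-bounded crossOrder-involutive (crossLayoutOf-preserves v)

  crossMember-injective : ∀ v w → crossMember p v ≡ crossMember p w → v ≡ w
  crossMember-injective v@(a ∷ b ∷ x ∷ y ∷ z ∷ []) w@(a′ ∷ b′ ∷ x′ ∷ y′ ∷ z′ ∷ []) same =
    let a≡ , b≡ , x≡ , y≡ , z≡ = crossPattern-injective (toℕ a) (toℕ b) (toℕ x) (toℕ y) (toℕ z) (nth (crossLayoutOf p v) 8)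
                                   (toℕ a′) (toℕ b′) (toℕ x′) (toℕ y′) (toℕ z′) (nth (crossLayoutOf p w) 8) same in
    cong₂ _∷_ (toℕ-injective a≡) (cong₂ _∷_ (toℕ-injective b≡) (cong₂ _∷_ (toℕ-injective x≡)
      (cong₂ _∷_ (toℕ-injective y≡) (cong (_∷ []) (toℕ-injective z≡)))))

  crossMember-length : ∀ v → length (crossMember p v) ≡ suc (8 * p)
  crossMember-length v = trans (CrossMember.length-blocks-sum v) (crossLayoutOf-sum v)

  crossMember-bounded : ∀ v → Bounded (crossMember p v) (suc (8 * p))
  crossMember-bounded v = subst (Bounded (crossMember p v)) (crossLayoutOf-sum v) (CrossMember.blocks-bounded v)

  crossVector : Vec (Fin p) 5 → Vec (Fin (suc (8 * p))) (suc (8 * p))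
  crossVector v = fromValues (crossMember p v) (crossMember-length v) (crossMember-bounded v)

  values-crossVector : ∀ v → values (crossVector v) ≡ crossMember p v
  values-crossVector v = values-fromValues (crossMember p v) _ _

  crossVector-injective : ∀ {v w} → crossVector v ≡ crossVector w → v ≡ w
  crossVector-injective {v} {w} eq =
    crossMember-injective v w (trans (sym (values-crossVector v)) (trans (cong values eq) (values-crossVector w)))

  crossVector-two-descents : ∀ v → HasInvDes (suc (8 * p)) 2 (crossVector v)
  crossVector-two-descents v =
    involutive⇒isInvolution (crossVector v) (subst Involutive (sym (values-crossVector v)) (CrossMember.blocks-involutive v)) ,
    trans (descents-values (crossVector v))
          (trans (cong descentsℕ (values-crossVector v)) (CrossMember.descents-blocks-ord v (crossLayoutOf-positive v)))

  invDes-2-≥ : p ^ 5 ≤ invDes (suc (8 * p)) 2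
  invDes-2-≥ = subst (_≤ invDes (suc (8 * p)) 2) length-codes
    (invDes-≥ (suc (8 * p)) 2 (allVecs (List.allFin p) 5) crossVector (allVecs-unique _ (Unique.allFin⁺ p) 5)
              crossVector-injective crossVector-two-descents)
    where
    length-codes : length (allVecs (List.allFin p) 5) ≡ p ^ 5
    length-codes = trans (length-allVecs (List.allFin p) 5) (cong (_^ 5) (List.length-tabulate {n = p} (λ i → i)))

invDes-0-≥ : ∀ n → 1 ≤ invDes n 0
invDes-0-≥ n = invDes-≥ n 0 (tt ∷ []) (λ _ → identity) (All.[] AllPairs.∷ AllPairs.[]) (λ _ → refl) (λ _ → identity-ascending)
  where
  <n : ∀ {i} → i < length (run 0 n) → i < n
  <n {i} = subst (i <_) (length-run 0 n)
  identity : Vec (Fin n) n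
  identity = fromValues (run 0 n) (length-run 0 n) (λ i i< → subst (_< n) (sym (nth-run 0 (<n i<))) (<n i<))
  values-identity : values identity ≡ run 0 n
  values-identity = values-fromValues (run 0 n) _ _
  identity-ascending : HasInvDes n 0 identity
  identity-ascending =
    involutive⇒isInvolution identity (subst Involutive (sym values-identity)
      (λ i i< → trans (cong (nth (run 0 n)) (nth-run 0 (<n i<))) (nth-run 0 (<n i<)))) ,
    trans (descents-values identity) (trans (cong descentsℕ values-identity) (descentsℕ-run 0 n))

not-log-concave-at-1 : ∀ p → let n = suc (8 * p) in n ^ 2 * n ^ 2 < p ^ 5 → invDes n 1 * invDes n 1 < invDes n 0 * invDes n 2
not-log-concave-at-1 p n⁴<p⁵ = begin-strict
  invDes n 1 * invDes n 1  ≤⟨ *-mono-≤ (invDes-1-≤ n) (invDes-1-≤ n) ⟩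
  n ^ 2 * n ^ 2            <⟨ n⁴<p⁵ ⟩
  p ^ 5                    ≤⟨ invDes-2-≥ p ⟩
  invDes n 2               ≡⟨ sym (*-identityˡ (invDes n 2)) ⟩
  1 * invDes n 2           ≤⟨ *-monoˡ-≤ (invDes n 2) (invDes-0-≥ n) ⟩
  invDes n 0 * invDes n 2  ∎
  where
  open ≤-Reasoning
  n : ℕ
  n = suc (8 * p)


theorem7 : Σ ℕ (λ n → Σ ℕ (λ j → (n > 0) × (invDes n j * invDes n (suc (suc j)) > invDes n (suc j) * invDes n (suc j))))
theorem7 = counterexample 4300 (<ᵇ⇒< _ _ tt)
  where
  -- p is kept abstract here: with a numeral, checking the types would evaluate invDes.
  counterexample : ∀ p → suc (8 * p) ^ 2 * suc (8 * p) ^ 2 < p ^ 5 →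
    Σ ℕ (λ n → Σ ℕ (λ j → (n > 0) × (invDes n j * invDes n (suc (suc j)) > invDes n (suc j) * invDes n (suc j))))
  counterexample p n⁴<p⁵ = suc (8 * p) , 0 , z<s , not-log-concave-at-1 p n⁴<p⁵
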